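{- In the one-shuffle model with $n\ge1$ cards and $h=\lceil n/2\rceil$, for $m\ge1$ let $M_m(h)=\sum_{1\le i_1<\dots<i_m\le h}C[Y_{i_1}\cdots Y_{i_m}]$ (an empty sum being $0$). Then for every integer $r\ge1$, $$C[Y_A^r]=\sum_{P}\frac{r!}{(p_1!)^{m_1}(p_2!)^{m_2}\cdots(p_s!)^{m_s}}\cdot\frac{m!}{m_1!\,m_2!\cdots m_s!}\,M_m(h),$$ where the sum runs over all integer partitions $P$ of $r$, written as $P=p_1^{(m_1)}+p_2^{(m_2)}+\dots+p_s^{(m_s)}$ with distinct parts $p_1,\dots,p_s$, part $p_l$ occurring $m_l$ times, and $m=m_1+\dots+m_s$ the number of parts of $P$.
   Context: One-shuffle model. Fix an integer $n\ge 1$ (cards $1,\dots,n$ initially in increasing order). An outcome of one riffle shuffle is a pair $(t,S)$ with $t\in\{0,\dots,n\}$, $S\subseteq\{1,\dots,n\}$, $|S|=t$: first pile $A=(1,\dots,t)$, second pile $B=(t+1,\dots,n)$; the permutation $\pi$ has the elements of $A$ in increasing order at the positions of $S$ and those of $B$ in increasing order elsewhere. The $2^n$ outcomes are regarded as distinct. For a function $W$ of the outcome, $C[W]$ is the sum of $W$ over all $2^n$ outcomes. Let $h=\lceil n/2\rceil$. For $1\le i\le h$, $Y_i$ is the indicator that $\pi(i)$ belongs to $A$ and $\pi(i)=\lfloor i/2\rfloor+1$, and $Y_A=\sum_{i=1}^h Y_i$. -}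

module Defs where

open import Data.Nat using (ℕ; zero; suc; _!; _+_; _*_; _∸_; _^_; _≡ᵇ_; _≤ᵇ_; _/_; NonZero; ⌊_/2⌋; ⌈_/2⌉)
open import Data.Nat.Properties using (m*n≢0; m^n≢0; _!≢0)
open import Data.Nat.ListAction using (sum; product)
open import Data.Bool using (Bool; true; false; if_then_else_; _∧_)
open import Data.List using (List; []; _∷_; map; concatMap; filter; upTo; replicate; _++_; take; length)
open import Data.Vec using (Vec; toList)
import Data.Vec as Vec
open import Relation.Nullary.Decidable using (does)
open import Data.Nat using (_≟_)
open import Function using (_∘_)

-- One-shuffle model.  Positions and card labels are 1-indexed naturals.
-- A subset S ⊆ {1..n} is a bit vector: position i ∈ S iff entry (i-1) is true.

allSubsets : (n : ℕ) → List (Vec Bool n)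
allSubsets zero    = Vec.[] ∷ []
allSubsets (suc n) = concatMap (λ v → (false Vec.∷ v) ∷ (true Vec.∷ v) ∷ []) (allSubsets n)

countTrue : List Bool → ℕ
countTrue []          = 0
countTrue (true ∷ bs)  = suc (countTrue bs)
countTrue (false ∷ bs) = countTrue bs

card : {n : ℕ} → Vec Bool n → ℕ
card S = countTrue (toList S)

memb : {n : ℕ} → Vec Bool n → ℕ → Bool
memb S i = go (toList S) i
  where
  go : List Bool → ℕ → Bool
  go []       _             = false
  go (b ∷ bs) zero          = false
  go (b ∷ bs) (suc zero)    = b
  go (b ∷ bs) (suc (suc k)) = go bs (suc k)

C : {n : ℕ} → (ℕ → Vec Bool n → ℕ) → ℕ
C {n} W = sum (map (λ t → sum (map (W t) (filter (λ S → card S ≟ t) (allSubsets n))))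
                   (upTo (suc n)))

-- π(i): the card at position i (1 ≤ i ≤ n) for outcome (t , S).
-- If i ∈ S it is the k-th card of A = (1..t), k = #{j ≤ i : j ∈ S};
-- otherwise it is the k-th card of B = (t+1..n), k = #{j ≤ i : j ∉ S}.
perm : {n : ℕ} → ℕ → Vec Bool n → ℕ → ℕ
perm t S i =
  let inS = countTrue (take i (toList S)) in
  if memb S i then inS else t + (i ∸ inS)

Y : {n : ℕ} → ℕ → ℕ → Vec Bool n → ℕ
Y i t S =
  if (1 ≤ᵇ perm t S i) ∧ (perm t S i ≤ᵇ t) ∧ (perm t S i ≡ᵇ suc ⌊ i /2⌋) then 1 else 0

positions : ℕ → List ℕ
positions h = map suc (upTo h)

YA : (n : ℕ) → ℕ → Vec Bool n → ℕ
YA n t S = sum (map (λ i → Y i t S) (positions ⌈ n /2⌉))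

choose : ℕ → List ℕ → List (List ℕ)
choose zero    _        = [] ∷ []
choose (suc m) []       = []
choose (suc m) (x ∷ xs) = map (x ∷_) (choose m xs) ++ choose (suc m) xs

M : (n : ℕ) → ℕ → ℕ
M n m = sum (map (λ is → C {n} (λ t S → product (map (λ i → Y i t S) is)))
                 (choose m (positions ⌈ n /2⌉)))

-- Integer partitions.  ptn k r = all partitions of r into parts ≤ k,
-- each listed as a weakly decreasing list of positive parts
-- (choose how many copies c of the part k, then recurse on parts ≤ k-1).

ptn : ℕ → ℕ → List (List ℕ)
ptn zero    zero    = [] ∷ []
ptn zero    (suc _) = []
ptn (suc k) r =
  concatMap (λ c → map (replicate c (suc k) ++_) (ptn k (r ∸ c * suc k)))
            (filter (λ c → c * suc k Data.Nat.≤? r) (upTo (suc r)))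

partitions : ℕ → List (List ℕ)
partitions r = ptn r r

mult : ℕ → List ℕ → ℕ
mult v P = length (filter (λ p → p ≟ v) P)

values : ℕ → List ℕ
values r = map suc (upTo r)

-- (p₁!)^{m₁} ⋯ (p_s!)^{m_s}  (values not occurring contribute (v!)^0 = 1)
denom1 : ℕ → List ℕ → ℕ
denom1 r P = product (map (λ v → (v !) ^ mult v P) (values r))

-- m₁! ⋯ m_s!  (values not occurring contribute 0! = 1)
denom2 : ℕ → List ℕ → ℕ
denom2 r P = product (map (λ v → (mult v P) !) (values r))

private
  prodNZ : (f : ℕ → ℕ) → (∀ v → NonZero (f v)) → (xs : List ℕ) → NonZero (product (map f xs))
  prodNZ f nz []       = _
  prodNZ f nz (x ∷ xs) = m*n≢0 (f x) (product (map f xs)) {{nz x}} {{prodNZ f nz xs}}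

denom1-nz : ∀ r P → NonZero (denom1 r P)
denom1-nz r P = prodNZ _ (λ v → m^n≢0 (v !) (mult v P) {{v !≢0}}) (values r)

denom2-nz : ∀ r P → NonZero (denom2 r P)
denom2-nz r P = prodNZ _ (λ v → (mult v P) !≢0) (values r)

-- the coefficient  r! / Π (p_l!)^{m_l}  ·  m! / Π m_l!   with m = number of parts
-- (both quotients are exact: they are multinomial coefficients)
coeff : ℕ → List ℕ → ℕ
coeff r P = ((r !) / denom1 r P) {{denom1-nz r P}}
          * (((length P) !) / denom2 r P) {{denom2-nz r P}}

RHS : (n r : ℕ) → ℕ
RHS n r = sum (map (λ P → coeff r P * M n (length P)) (partitions r))

LHS : (n r : ℕ) → ℕ
LHS n r = C (λ t S → YA n t S ^ r)

-- Each Y_i is 0 or 1, so Σ_{i₁<…<i_m} Y_{i₁}⋯Y_{i_m} = binom(Y_A, m) and M_m(h) = C[binom(Y_A, m)];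
-- by linearity of C the statement reduces to the identity x^r = Σ_P coeff(r, P) · binom(x, |P|) over ℕ.
-- Both sides count the maps from an r-set to an x-set, P recording the sizes of the nonempty fibres.
-- The identity goes through the number of such maps whose fibres all have at most k elements: it is
-- x^r once k ≥ r, and sorting the maps by how many fibres have the maximal size k + 1 gives a
-- recursion in k that mirrors the way ptn builds partitions, largest part first.

module Submission where

open import Defs
open import Data.Bool using (Bool; true; false; if_then_else_)
open import Data.Fin using (toℕ)
open import Data.List using (List; []; _∷_; _++_; map; concatMap; filter; replicate; length; upTo; applyUpTo)
open import Data.List.Properties
  using (map-cong; map-cong-local; map-++; map-∘; map-applyUpTo; length-++; length-replicate;
         filter-++; filter-all; filter-none; filter-accept; filter-reject)
open import Data.List.Relation.Unary.All as All using (All; []; _∷_)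
open import Data.List.Relation.Unary.All.Properties using (replicate⁺; ++⁺; map⁺; concat⁺; all-filter)
open import Data.Nat
  using (ℕ; zero; suc; ⌈_/2⌉; _+_; _*_; _∸_; _^_; _!; _≤_; _<_; _≤?_; _≟_; _≡ᵇ_; z≤n; s≤s; NonZero; +-0-rawMonoid)
open import Data.Nat.Properties
import Data.Nat.Combinatorics as Combinatorics
open import Data.Nat.Divisibility using (_∣_; divides; quotient)
open import Data.Nat.DivMod using (_/_; m/n*n≡m; m*n/n≡m)
open import Data.Nat.ListAction using (sum; product)
open import Data.Nat.ListAction.Properties using (sum-++)
open import Data.Nat.Tactic.RingSolver using (solve-∀)
open import Data.Sum using (_⊎_; inj₁; inj₂)
open import Data.Vec using (Vec)
open import Function using (_∘_)
open import Relation.Binary.PropositionalEquality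
open import Relation.Nullary using (Dec; yes; no; ¬_)
open import Relation.Unary using (Decidable)
import Algebra.Definitions.RawMonoid +-0-rawMonoid as Multiple
import Algebra.Properties.Monoid.Sum +-0-monoid as FinSum
import Algebra.Properties.Semiring.Exp +-*-semiring as Exp
import Algebra.Properties.CommutativeSemiring.Binomial +-*-commutativeSemiring as Binomial

-- Arithmetic and finite sums

n≡0⇒m*n≡0 : ∀ m {n} → n ≡ 0 → m * n ≡ 0
n≡0⇒m*n≡0 m refl = *-zeroʳ m

m≡0⇒m*n≡0 : ∀ {m} n → m ≡ 0 → m * n ≡ 0
m≡0⇒m*n≡0 n refl = refl

∸-comm : ∀ r a j → r ∸ a ∸ j ≡ r ∸ j ∸ a
∸-comm r a j = trans (∸-+-assoc r a j) (trans (cong (r ∸_) (+-comm a j)) (sym (∸-+-assoc r j a)))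

sum-map-distribˡ-* : ∀ {A : Set} k (f : A → ℕ) xs → sum (map (λ x → k * f x) xs) ≡ k * sum (map f xs)
sum-map-distribˡ-* k f []       = sym (*-zeroʳ k)
sum-map-distribˡ-* k f (x ∷ xs) = trans (cong (k * f x +_) (sum-map-distribˡ-* k f xs)) (sym (*-distribˡ-+ k (f x) _))

sum-map-zero : ∀ {A : Set} (xs : List A) → sum (map (λ _ → 0) xs) ≡ 0
sum-map-zero []       = refl
sum-map-zero (x ∷ xs) = sum-map-zero xs

sum-map-+ : ∀ {A : Set} (f g : A → ℕ) xs → sum (map (λ x → f x + g x) xs) ≡ sum (map f xs) + sum (map g xs)
sum-map-+ f g []       = refl
sum-map-+ f g (x ∷ xs) = trans (cong (f x + g x +_) (sum-map-+ f g xs)) (interchange (f x) (g x) _ _)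
  where
  interchange : ∀ a b c d → a + b + (c + d) ≡ a + c + (b + d)
  interchange = solve-∀

sum-map-comm : ∀ {A B : Set} (F : A → B → ℕ) xs ys →
               sum (map (λ a → sum (map (F a) ys)) xs) ≡ sum (map (λ b → sum (map (λ a → F a b) xs)) ys)
sum-map-comm F []       ys = sym (sum-map-zero ys)
sum-map-comm F (x ∷ xs) ys =
  trans (cong (sum (map (F x) ys) +_) (sum-map-comm F xs ys)) (sym (sum-map-+ (F x) _ ys))

sum-map-concatMap : ∀ {A B : Set} (f : B → ℕ) (F : A → List B) xs →
                    sum (map f (concatMap F xs)) ≡ sum (map (λ a → sum (map f (F a))) xs)
sum-map-concatMap f F []       = refl
sum-map-concatMap f F (x ∷ xs) =
  trans (cong sum (map-++ f (F x) (concatMap F xs)))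
        (trans (sum-++ (map f (F x)) _) (cong (sum (map f (F x)) +_) (sum-map-concatMap f F xs)))

sum-map-filter : ∀ {P : ℕ → Set} (P? : Decidable P) (f : ℕ → ℕ) → (∀ x → ¬ P x → f x ≡ 0) →
                 ∀ xs → sum (map f (filter P? xs)) ≡ sum (map f xs)
sum-map-filter P? f f≡0 []       = refl
sum-map-filter P? f f≡0 (x ∷ xs) with P? x
... | yes _  = cong (f x +_) (sum-map-filter P? f f≡0 xs)
... | no ¬Px = trans (sum-map-filter P? f f≡0 xs) (cong (_+ sum (map f xs)) (sym (f≡0 x ¬Px)))

product-map-* : ∀ {A : Set} (f g : A → ℕ) xs → product (map (λ v → f v * g v) xs) ≡ product (map f xs) * product (map g xs)
product-map-* f g []       = refl
product-map-* f g (x ∷ xs) = trans (cong (f x * g x *_) (product-map-* f g xs)) (interchange (f x) (g x) _ _)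
  where
  interchange : ∀ a b c d → a * b * (c * d) ≡ a * c * (b * d)
  interchange = solve-∀

product-map-1 : ∀ {A : Set} (xs : List A) → product (map (λ _ → 1) xs) ≡ 1
product-map-1 []       = refl
product-map-1 (x ∷ xs) = trans (+-identityʳ _) (product-map-1 xs)

sumBelow : ℕ → (ℕ → ℕ) → ℕ
sumBelow zero    f = 0
sumBelow (suc N) f = f 0 + sumBelow N (f ∘ suc)

syntax sumBelow N (λ i → e) = ∑[ i < N ] e

sumBelow-cong : ∀ N {f g : ℕ → ℕ} → (∀ i → f i ≡ g i) → sumBelow N f ≡ sumBelow N g
sumBelow-cong zero    f≗g = refl
sumBelow-cong (suc N) f≗g = cong₂ _+_ (f≗g 0) (sumBelow-cong N (f≗g ∘ suc))

sumBelow-zero : ∀ N {f : ℕ → ℕ} → (∀ i → f i ≡ 0) → sumBelow N f ≡ 0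
sumBelow-zero zero    f≗0 = refl
sumBelow-zero (suc N) f≗0 = cong₂ _+_ (f≗0 0) (sumBelow-zero N (f≗0 ∘ suc))

sumBelow-distrib-+ : ∀ N (f g : ℕ → ℕ) → ∑[ i < N ] (f i + g i) ≡ sumBelow N f + sumBelow N g
sumBelow-distrib-+ zero    f g = refl
sumBelow-distrib-+ (suc N) f g =
  trans (cong (f 0 + g 0 +_) (sumBelow-distrib-+ N (f ∘ suc) (g ∘ suc)))
        (+-interchange (f 0) (g 0) _ _)
  where
  +-interchange : ∀ a b c d → a + b + (c + d) ≡ a + c + (b + d)
  +-interchange = solve-∀

sumBelow-distribˡ-* : ∀ N k (f : ℕ → ℕ) → ∑[ i < N ] (k * f i) ≡ k * sumBelow N f
sumBelow-distribˡ-* zero    k f = sym (*-zeroʳ k)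
sumBelow-distribˡ-* (suc N) k f =
  trans (cong (k * f 0 +_) (sumBelow-distribˡ-* N k (f ∘ suc))) (sym (*-distribˡ-+ k (f 0) _))

sumBelow-last : ∀ N (f : ℕ → ℕ) → sumBelow (suc N) f ≡ sumBelow N f + f N
sumBelow-last zero    f = +-comm (f 0) 0
sumBelow-last (suc N) f = trans (cong (f 0 +_) (sumBelow-last N (f ∘ suc))) (sym (+-assoc (f 0) _ _))

sumBelow-comm : ∀ N M (f : ℕ → ℕ → ℕ) →
                ∑[ i < N ] sumBelow M (f i) ≡ ∑[ j < M ] ∑[ i < N ] f i j
sumBelow-comm zero    M f = sym (sumBelow-zero M (λ _ → refl))
sumBelow-comm (suc N) M f =
  trans (cong (sumBelow M (f 0) +_) (sumBelow-comm N M (f ∘ suc))) (sym (sumBelow-distrib-+ M _ _))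

sumBelow-truncate : ∀ M N (f : ℕ → ℕ) → M ≤ N → (∀ j → M ≤ j → f j ≡ 0) → sumBelow N f ≡ sumBelow M f
sumBelow-truncate zero    N       f _         f≡0 = sumBelow-zero N (λ j → f≡0 j z≤n)
sumBelow-truncate (suc M) (suc N) f (s≤s M≤N) f≡0 =
  cong (f 0 +_) (sumBelow-truncate M N (f ∘ suc) M≤N (λ j M≤j → f≡0 (suc j) (s≤s M≤j)))

FinSum-sum≡sumBelow : ∀ N (f : ℕ → ℕ) → FinSum.sum (f ∘ toℕ {N}) ≡ sumBelow N f
FinSum-sum≡sumBelow zero    f = refl
FinSum-sum≡sumBelow (suc N) f = cong (f 0 +_) (FinSum-sum≡sumBelow N (f ∘ suc))

sum-map-applyUpTo : ∀ (f g : ℕ → ℕ) N → sum (map f (applyUpTo g N)) ≡ sumBelow N (f ∘ g)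
sum-map-applyUpTo f g zero    = refl
sum-map-applyUpTo f g (suc N) = cong (f (g 0) +_) (sum-map-applyUpTo f (g ∘ suc) N)

-- Binomial coefficients and blocks

-- Pascal's rule as the definition (unlike Data.Nat.Combinatorics._C_), so that it reduces by computation.
binomial : ℕ → ℕ → ℕ
binomial n       zero    = 1
binomial zero    (suc k) = 0
binomial (suc n) (suc k) = binomial n k + binomial n (suc k)

n<k⇒binomial≡0 : ∀ {n k} → n < k → binomial n k ≡ 0
n<k⇒binomial≡0 {zero}  {suc k} _         = refl
n<k⇒binomial≡0 {suc n} {suc k} (s≤s n<k) = cong₂ _+_ (n<k⇒binomial≡0 n<k) (n<k⇒binomial≡0 (m<n⇒m<1+n n<k))

binomial≡C : ∀ n k → binomial n k ≡ n Combinatorics.C k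
binomial≡C n       zero    = refl
binomial≡C zero    (suc k) = refl
binomial≡C (suc n) (suc k) =
  trans (cong₂ _+_ (binomial≡C n k) (binomial≡C n (suc k))) (Combinatorics.nCk+nC[k+1]≡[n+1]C[k+1] n k)

binomial*k!*[n∸k]!≡n! : ∀ {n k} → k ≤ n → binomial n k * (k ! * (n ∸ k) !) ≡ n !
binomial*k!*[n∸k]!≡n! {n} {k} k≤n = begin
  binomial n k * (k ! * (n ∸ k) !)                          ≡⟨ cong (_* (k ! * (n ∸ k) !)) (binomial≡C n k) ⟩
  (n Combinatorics.C k) * (k ! * (n ∸ k) !)                 ≡⟨ cong (_* (k ! * (n ∸ k) !)) (Combinatorics.nCk≡n!/k![n-k]! k≤n) ⟩
  (n ! / (k ! * (n ∸ k) !)) {{_}} * (k ! * (n ∸ k) !)        ≡⟨ m/n*n≡m {{k !* (n ∸ k) !≢0}} (Combinatorics.k![n∸k]!∣n! k≤n) ⟩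
  n !                                                       ∎
  where open ≡-Reasoning

binomial[m+n,m]*m!*n!≡[m+n]! : ∀ m n → binomial (m + n) m * (m ! * n !) ≡ (m + n) !
binomial[m+n,m]*m!*n!≡[m+n]! m n =
  trans (cong (λ d → binomial (m + n) m * (m ! * d !)) (sym (m+n∸m≡n m n)))
        (binomial*k!*[n∸k]!≡n! (m≤m+n m n))

binomial-sym : ∀ m n → binomial (m + n) m ≡ binomial (m + n) n
binomial-sym m n = *-cancelʳ-≡ _ _ (m ! * n !) {{m !* n !≢0}} (begin
  binomial (m + n) m * (m ! * n !) ≡⟨ binomial[m+n,m]*m!*n!≡[m+n]! m n ⟩
  (m + n) !                        ≡⟨ cong _! (+-comm m n) ⟩
  (n + m) !                        ≡⟨ binomial[m+n,m]*m!*n!≡[m+n]! n m ⟨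
  binomial (n + m) n * (n ! * m !) ≡⟨ cong₂ (λ s d → binomial s n * d) (+-comm n m) (*-comm (n !) (m !)) ⟩
  binomial (m + n) n * (m ! * n !) ∎)
  where open ≡-Reasoning

binomial-trinomial : ∀ c m x → binomial (c + m) c * binomial x (c + m) ≡ binomial x c * binomial (x ∸ c) m
binomial-trinomial c m x with c + m ≤? x | c ≤? x
... | yes c+m≤x | _ = *-cancelʳ-≡ _ _ (c ! * m ! * s !) {{m*n≢0 _ _ {{c !* m !≢0}} {{s !≢0}}}}
                                  (trans left≡x! (sym right≡x!))
  where
  open ≡-Reasoning
  s = x ∸ c ∸ m
  c≤x = ≤-trans (m≤m+n c m) c+m≤x
  m≤x∸c = m+n≤o⇒m≤o∸n m (subst (_≤ x) (+-comm c m) c+m≤x)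
  left≡x! : binomial (c + m) c * binomial x (c + m) * (c ! * m ! * s !) ≡ x !
  left≡x! = begin
    binomial (c + m) c * binomial x (c + m) * (c ! * m ! * s !)
      ≡⟨ rearrange (binomial (c + m) c) (binomial x (c + m)) (c !) (m !) (s !) ⟩
    binomial x (c + m) * (binomial (c + m) c * (c ! * m !) * s !)
      ≡⟨ cong₂ (λ u v → binomial x (c + m) * (u * v !)) (binomial[m+n,m]*m!*n!≡[m+n]! c m) (∸-+-assoc x c m) ⟩
    binomial x (c + m) * ((c + m) ! * (x ∸ (c + m)) !)
      ≡⟨ binomial*k!*[n∸k]!≡n! c+m≤x ⟩
    x ! ∎
    where
    rearrange : ∀ a b p q u → a * b * (p * q * u) ≡ b * (a * (p * q) * u)
    rearrange = solve-∀
  right≡x! : binomial x c * binomial (x ∸ c) m * (c ! * m ! * s !) ≡ x !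
  right≡x! = begin
    binomial x c * binomial (x ∸ c) m * (c ! * m ! * s !)
      ≡⟨ rearrange (binomial x c) (binomial (x ∸ c) m) (c !) (m !) (s !) ⟩
    binomial x c * (c ! * (binomial (x ∸ c) m * (m ! * s !)))
      ≡⟨ cong (λ u → binomial x c * (c ! * u)) (binomial*k!*[n∸k]!≡n! m≤x∸c) ⟩
    binomial x c * (c ! * (x ∸ c) !)
      ≡⟨ binomial*k!*[n∸k]!≡n! c≤x ⟩
    x ! ∎
    where
    rearrange : ∀ a b p q u → a * b * (p * q * u) ≡ a * (p * (b * (q * u)))
    rearrange = solve-∀
... | no c+m≰x | yes c≤x = trans (n≡0⇒m*n≡0 (binomial (c + m) c) (n<k⇒binomial≡0 (≰⇒> c+m≰x)))
                                (sym (n≡0⇒m*n≡0 (binomial x c) (n<k⇒binomial≡0 x∸c<m)))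
  where
  x∸c<m : x ∸ c < m
  x∸c<m = +-cancelˡ-< c _ _ (subst (_< c + m) (sym (m+[n∸m]≡n c≤x)) (≰⇒> c+m≰x))
... | no c+m≰x | no c≰x = trans (n≡0⇒m*n≡0 (binomial (c + m) c) (n<k⇒binomial≡0 (≰⇒> c+m≰x)))
                               (sym (m≡0⇒m*n≡0 (binomial (x ∸ c) m) (n<k⇒binomial≡0 (≰⇒> c≰x))))

binomial*binomial-comm : ∀ r a j → binomial r a * binomial (r ∸ a) j ≡ binomial r j * binomial (r ∸ j) a
binomial*binomial-comm r a j = begin
  binomial r a * binomial (r ∸ a) j         ≡⟨ binomial-trinomial a j r ⟨
  binomial (a + j) a * binomial r (a + j)   ≡⟨ cong₂ (λ u v → u * binomial r v) (binomial-sym a j) (+-comm a j) ⟩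
  binomial (a + j) j * binomial r (j + a)   ≡⟨ cong (λ u → binomial u j * binomial r (j + a)) (+-comm a j) ⟩
  binomial (j + a) j * binomial r (j + a)   ≡⟨ binomial-trinomial j a r ⟩
  binomial r j * binomial (r ∸ j) a         ∎
  where open ≡-Reasoning

×≡* : ∀ m n → m Multiple.× n ≡ m * n
×≡* zero    n = refl
×≡* (suc m) n = cong (n +_) (×≡* m n)

Exp-^≡^ : ∀ x n → x Exp.^ n ≡ x ^ n
Exp-^≡^ x zero    = refl
Exp-^≡^ x (suc n) = cong (x *_) (Exp-^≡^ x n)

binomial-theorem : ∀ x r → ∑[ j < suc r ] (binomial r j * x ^ (r ∸ j)) ≡ suc x ^ r
binomial-theorem x r = begin
  ∑[ j < suc r ] (binomial r j * x ^ (r ∸ j))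
    ≡⟨ sumBelow-cong (suc r) term≡ ⟨
  ∑[ j < suc r ] ((r Combinatorics.C j) Multiple.× (1 Exp.^ j * x Exp.^ (r ∸ j)))
    ≡⟨ FinSum-sum≡sumBelow (suc r) (λ j → (r Combinatorics.C j) Multiple.× (1 Exp.^ j * x Exp.^ (r ∸ j))) ⟨
  Binomial.binomialExpansion 1 x r
    ≡⟨ Binomial.theorem r 1 x ⟨
  suc x Exp.^ r
    ≡⟨ Exp-^≡^ (suc x) r ⟩
  suc x ^ r ∎
  where
  open ≡-Reasoning
  term≡ : ∀ j → (r Combinatorics.C j) Multiple.× (1 Exp.^ j * x Exp.^ (r ∸ j)) ≡ binomial r j * x ^ (r ∸ j)
  term≡ j = begin
    (r Combinatorics.C j) Multiple.× (1 Exp.^ j * x Exp.^ (r ∸ j))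
      ≡⟨ ×≡* (r Combinatorics.C j) _ ⟩
    (r Combinatorics.C j) * (1 Exp.^ j * x Exp.^ (r ∸ j))
      ≡⟨ cong₂ (λ u v → (r Combinatorics.C j) * (u * v)) (trans (Exp-^≡^ 1 j) (^-zeroˡ j)) (Exp-^≡^ x (r ∸ j)) ⟩
    (r Combinatorics.C j) * (1 * x ^ (r ∸ j))
      ≡⟨ cong₂ _*_ (binomial≡C r j) (sym (*-identityˡ (x ^ (r ∸ j)))) ⟨
    binomial r j * x ^ (r ∸ j) ∎

-- blocks r c a = r! / ((a!)^c (r ∸ c a)!), the number of sequences of c disjoint a-subsets of an r-set.
blocks : ℕ → ℕ → ℕ → ℕ
blocks r zero    a = 1
blocks r (suc c) a = binomial r a * blocks (r ∸ a) c a

r<c*a⇒blocks≡0 : ∀ {r} c {a} → r < c * a → blocks r c a ≡ 0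
r<c*a⇒blocks≡0 {r} (suc c) {a} r<a+c*a with a ≤? r
... | no a≰r  = m≡0⇒m*n≡0 (blocks (r ∸ a) c a) (n<k⇒binomial≡0 (≰⇒> a≰r))
... | yes a≤r = n≡0⇒m*n≡0 (binomial r a) (r<c*a⇒blocks≡0 c r∸a<c*a)
  where
  r∸a<c*a : r ∸ a < c * a
  r∸a<c*a = +-cancelˡ-< a _ _ (subst (_< a + c * a) (sym (m+[n∸m]≡n a≤r)) r<a+c*a)

blocks*[a!]^c*[r∸c*a]!≡r! : ∀ r c a → c * a ≤ r → blocks r c a * ((a !) ^ c * (r ∸ c * a) !) ≡ r !
blocks*[a!]^c*[r∸c*a]!≡r! r zero    a _       = trans (*-identityˡ _) (+-identityʳ _)
blocks*[a!]^c*[r∸c*a]!≡r! r (suc c) a a+ca≤r = begin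
  binomial r a * blocks (r ∸ a) c a * (a ! * (a !) ^ c * (r ∸ (a + c * a)) !)
    ≡⟨ rearrange (binomial r a) (blocks (r ∸ a) c a) (a !) ((a !) ^ c) _ ⟩
  binomial r a * (a ! * (blocks (r ∸ a) c a * ((a !) ^ c * (r ∸ (a + c * a)) !)))
    ≡⟨ cong (λ d → binomial r a * (a ! * (blocks (r ∸ a) c a * ((a !) ^ c * d !)))) (∸-+-assoc r a (c * a)) ⟨
  binomial r a * (a ! * (blocks (r ∸ a) c a * ((a !) ^ c * (r ∸ a ∸ c * a) !)))
    ≡⟨ cong (λ u → binomial r a * (a ! * u)) (blocks*[a!]^c*[r∸c*a]!≡r! (r ∸ a) c a c*a≤r∸a) ⟩
  binomial r a * (a ! * (r ∸ a) !)
    ≡⟨ binomial*k!*[n∸k]!≡n! (≤-trans (m≤m+n a (c * a)) a+ca≤r) ⟩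
  r ! ∎
  where
  open ≡-Reasoning
  rearrange : ∀ b u p q w → b * u * (p * q * w) ≡ b * (p * (u * (q * w)))
  rearrange = solve-∀
  c*a≤r∸a : c * a ≤ r ∸ a
  c*a≤r∸a = m+n≤o⇒m≤o∸n (c * a) (subst (_≤ r) (+-comm a (c * a)) a+ca≤r)

blocks*binomial-comm : ∀ r c a j → blocks r c a * binomial (r ∸ c * a) j ≡ binomial r j * blocks (r ∸ j) c a
blocks*binomial-comm r zero    a j = trans (+-identityʳ _) (sym (*-identityʳ _))
blocks*binomial-comm r (suc c) a j = begin
  binomial r a * blocks (r ∸ a) c a * binomial (r ∸ (a + c * a)) j
    ≡⟨ cong (λ d → binomial r a * blocks (r ∸ a) c a * binomial d j) (∸-+-assoc r a (c * a)) ⟨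
  binomial r a * blocks (r ∸ a) c a * binomial (r ∸ a ∸ c * a) j
    ≡⟨ *-assoc (binomial r a) _ _ ⟩
  binomial r a * (blocks (r ∸ a) c a * binomial (r ∸ a ∸ c * a) j)
    ≡⟨ cong (binomial r a *_) (blocks*binomial-comm (r ∸ a) c a j) ⟩
  binomial r a * (binomial (r ∸ a) j * blocks (r ∸ a ∸ j) c a)
    ≡⟨ *-assoc (binomial r a) _ _ ⟨
  binomial r a * binomial (r ∸ a) j * blocks (r ∸ a ∸ j) c a
    ≡⟨ cong₂ (λ u d → u * blocks d c a) (binomial*binomial-comm r a j) (∸-comm r a j) ⟩
  binomial r j * binomial (r ∸ j) a * blocks (r ∸ j ∸ a) c a
    ≡⟨ *-assoc (binomial r j) _ _ ⟩
  binomial r j * (binomial (r ∸ j) a * blocks (r ∸ j ∸ a) c a) ∎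
  where open ≡-Reasoning

-- Maps with bounded fibres

-- The number of maps from an r-set to an x-set all of whose fibres have at most k elements.
cappedMaps : ℕ → ℕ → ℕ → ℕ
cappedMaps k r       (suc x) = ∑[ j < suc k ] (binomial r j * cappedMaps k (r ∸ j) x)
cappedMaps k zero    zero    = 1
cappedMaps k (suc r) zero    = 0

cappedMaps-zeroBoxes : ∀ k k′ r → cappedMaps k r 0 ≡ cappedMaps k′ r 0
cappedMaps-zeroBoxes k k′ zero    = refl
cappedMaps-zeroBoxes k k′ (suc r) = refl

cappedMaps-zeroCap : ∀ r x → cappedMaps 0 r x ≡ cappedMaps 0 r 0
cappedMaps-zeroCap r zero    = refl
cappedMaps-zeroCap r (suc x) = trans (+-identityʳ _) (trans (+-identityʳ _) (cappedMaps-zeroCap r x))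

cappedMaps-pow : ∀ k r x → r ≤ k → cappedMaps k r x ≡ x ^ r
cappedMaps-pow k zero    zero    _   = refl
cappedMaps-pow k (suc r) zero    _   = refl
cappedMaps-pow k r       (suc x) r≤k = begin
  ∑[ j < suc k ] (binomial r j * cappedMaps k (r ∸ j) x)
    ≡⟨ sumBelow-cong (suc k) (λ j → cong (binomial r j *_) (cappedMaps-pow k (r ∸ j) x (≤-trans (m∸n≤m r j) r≤k))) ⟩
  ∑[ j < suc k ] (binomial r j * x ^ (r ∸ j))
    ≡⟨ sumBelow-truncate (suc r) (suc k) (λ j → binomial r j * x ^ (r ∸ j)) (s≤s r≤k) (λ j r<j → m≡0⇒m*n≡0 _ (n<k⇒binomial≡0 r<j)) ⟩
  ∑[ j < suc r ] (binomial r j * x ^ (r ∸ j))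
    ≡⟨ binomial-theorem x r ⟩
  suc x ^ r ∎
  where open ≡-Reasoning

-- Sorting maps with fibres of size ≤ k + 1 by the number c of fibres of size exactly k + 1.
fullFibreSum : ℕ → ℕ → ℕ → ℕ → ℕ
fullFibreSum k N r x = ∑[ c < N ] (blocks r c (suc k) * binomial x c * cappedMaps k (r ∸ c * suc k) (x ∸ c))

fullFibreTerm-suc : ∀ k r x c →
  blocks r c (suc k) * binomial x c * cappedMaps k (r ∸ c * suc k) (suc x ∸ c) ≡
  ∑[ j < suc k ] (binomial r j * (blocks (r ∸ j) c (suc k) * binomial x c * cappedMaps k (r ∸ j ∸ c * suc k) (x ∸ c)))
fullFibreTerm-suc k r x c with c ≤? x
... | no c≰x = trans (vanishes r (suc x ∸ c))
                     (sym (sumBelow-zero a (λ j → n≡0⇒m*n≡0 (binomial r j) (vanishes (r ∸ j) (x ∸ c)))))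
  where
  a = suc k
  vanishes : ∀ u y → blocks u c a * binomial x c * cappedMaps k (u ∸ c * a) y ≡ 0
  vanishes u y = m≡0⇒m*n≡0 _ (n≡0⇒m*n≡0 (blocks u c a) (n<k⇒binomial≡0 (≰⇒> c≰x)))
... | yes c≤x = begin
  βc * bx * cappedMaps k (r ∸ c * a) (suc x ∸ c)
    ≡⟨ cong (λ y → βc * bx * cappedMaps k (r ∸ c * a) y) (+-∸-assoc 1 c≤x) ⟩
  βc * bx * ∑[ j < a ] (binomial (r ∸ c * a) j * cappedMaps k (r ∸ c * a ∸ j) (x ∸ c))
    ≡⟨ sumBelow-distribˡ-* a (βc * bx) (λ j → binomial (r ∸ c * a) j * cappedMaps k (r ∸ c * a ∸ j) (x ∸ c)) ⟨
  ∑[ j < a ] (βc * bx * (binomial (r ∸ c * a) j * cappedMaps k (r ∸ c * a ∸ j) (x ∸ c)))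
    ≡⟨ sumBelow-cong a term≡ ⟩
  ∑[ j < a ] (binomial r j * (blocks (r ∸ j) c a * bx * cappedMaps k (r ∸ j ∸ c * a) (x ∸ c))) ∎
  where
  open ≡-Reasoning
  a = suc k
  βc = blocks r c a
  bx = binomial x c
  term≡ : ∀ j → βc * bx * (binomial (r ∸ c * a) j * cappedMaps k (r ∸ c * a ∸ j) (x ∸ c))
              ≡ binomial r j * (blocks (r ∸ j) c a * bx * cappedMaps k (r ∸ j ∸ c * a) (x ∸ c))
  term≡ j = begin
    βc * bx * (binomial (r ∸ c * a) j * cappedMaps k (r ∸ c * a ∸ j) (x ∸ c))
      ≡⟨ swap-middle βc bx (binomial (r ∸ c * a) j) _ ⟩
    βc * binomial (r ∸ c * a) j * (bx * cappedMaps k (r ∸ c * a ∸ j) (x ∸ c))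
      ≡⟨ cong₂ (λ u d → u * (bx * cappedMaps k d (x ∸ c))) (blocks*binomial-comm r c a j) (∸-comm r (c * a) j) ⟩
    binomial r j * blocks (r ∸ j) c a * (bx * cappedMaps k (r ∸ j ∸ c * a) (x ∸ c))
      ≡⟨ reassociate (binomial r j) (blocks (r ∸ j) c a) bx _ ⟩
    binomial r j * (blocks (r ∸ j) c a * bx * cappedMaps k (r ∸ j ∸ c * a) (x ∸ c)) ∎
    where
    swap-middle : ∀ u v w z → u * v * (w * z) ≡ u * w * (v * z)
    swap-middle = solve-∀
    reassociate : ∀ u v w z → u * v * (w * z) ≡ u * (v * w * z)
    reassociate = solve-∀

fullFibreSum-pascal : ∀ k N r x →
  ∑[ c < suc N ] (blocks r c (suc k) * binomial x c * cappedMaps k (r ∸ c * suc k) (suc x ∸ c)) +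
  ∑[ c < N ] (blocks r (suc c) (suc k) * binomial x c * cappedMaps k (r ∸ suc c * suc k) (x ∸ c))
  ≡ fullFibreSum k (suc N) r (suc x)
fullFibreSum-pascal k N r x =
  trans (+-assoc (cappedMaps k r (suc x) + 0) _ _)
        (cong (cappedMaps k r (suc x) + 0 +_)
              (trans (sym (sumBelow-distrib-+ N _ _)) (sumBelow-cong N pascal)))
  where
  β h : ℕ → ℕ
  β c = blocks r (suc c) (suc k)
  h c = cappedMaps k (r ∸ suc c * suc k) (x ∸ c)
  pascal : ∀ c → β c * binomial x (suc c) * h c + β c * binomial x c * h c ≡ β c * binomial (suc x) (suc c) * h c
  pascal c = factor (β c) (binomial x c) (binomial x (suc c)) (h c)
    where
    factor : ∀ m p q h → m * q * h + m * p * h ≡ m * (p + q) * h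
    factor = solve-∀

FullFibreExpansion : ℕ → ℕ → Set
FullFibreExpansion k x = ∀ N r → r < N → cappedMaps (suc k) r x ≡ fullFibreSum k N r x

fullFibreExpansion-zero : ∀ k → FullFibreExpansion k 0
fullFibreExpansion-zero k (suc N) r _ = sym (begin
  cappedMaps k r 0 + 0 + ∑[ c < N ] (blocks r (suc c) (suc k) * 0 * cappedMaps k (r ∸ suc c * suc k) 0)
    ≡⟨ cong₂ _+_ (+-identityʳ _) (sumBelow-zero N (λ c → m≡0⇒m*n≡0 _ (*-zeroʳ (blocks r (suc c) (suc k))))) ⟩
  cappedMaps k r 0 + 0
    ≡⟨ +-identityʳ _ ⟩
  cappedMaps k r 0
    ≡⟨ cappedMaps-zeroBoxes k (suc k) r ⟩
  cappedMaps (suc k) r 0 ∎)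
  where open ≡-Reasoning

lastFibre-notFull : ∀ {k x} → FullFibreExpansion k x → ∀ N r → r < suc N →
  ∑[ j < suc k ] (binomial r j * cappedMaps (suc k) (r ∸ j) x) ≡
  ∑[ c < suc N ] (blocks r c (suc k) * binomial x c * cappedMaps k (r ∸ c * suc k) (suc x ∸ c))
lastFibre-notFull {k} {x} expand N r r<1+N = begin
  ∑[ j < a ] (binomial r j * cappedMaps a (r ∸ j) x)
    ≡⟨ sumBelow-cong a (λ j → cong (binomial r j *_) (expand (suc N) (r ∸ j) (≤-<-trans (m∸n≤m r j) r<1+N))) ⟩
  ∑[ j < a ] (binomial r j * ∑[ c < suc N ] term (r ∸ j) c)
    ≡⟨ sumBelow-cong a (λ j → sumBelow-distribˡ-* (suc N) (binomial r j) (term (r ∸ j))) ⟨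
  ∑[ j < a ] ∑[ c < suc N ] (binomial r j * term (r ∸ j) c)
    ≡⟨ sumBelow-comm a (suc N) (λ j c → binomial r j * term (r ∸ j) c) ⟩
  ∑[ c < suc N ] ∑[ j < a ] (binomial r j * term (r ∸ j) c)
    ≡⟨ sumBelow-cong (suc N) (fullFibreTerm-suc k r x) ⟨
  ∑[ c < suc N ] (blocks r c a * binomial x c * cappedMaps k (r ∸ c * a) (suc x ∸ c)) ∎
  where
  open ≡-Reasoning
  a = suc k
  term : ℕ → ℕ → ℕ
  term u c = blocks u c a * binomial x c * cappedMaps k (u ∸ c * a) (x ∸ c)

lastFibre-full : ∀ {k x} → FullFibreExpansion k x → ∀ N r → r < suc N →
  binomial r (suc k) * cappedMaps (suc k) (r ∸ suc k) x ≡
  ∑[ c < N ] (blocks r (suc c) (suc k) * binomial x c * cappedMaps k (r ∸ suc c * suc k) (x ∸ c))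
lastFibre-full         expand N zero     _          = sym (sumBelow-zero N (λ _ → refl))
lastFibre-full {k} {x} expand N (suc r) (s≤s r<N) = begin
  binomial (suc r) a * cappedMaps a (r ∸ k) x
    ≡⟨ cong (binomial (suc r) a *_) (expand N (r ∸ k) (≤-<-trans (m∸n≤m r k) r<N)) ⟩
  binomial (suc r) a * ∑[ c < N ] term c
    ≡⟨ sumBelow-distribˡ-* N (binomial (suc r) a) term ⟨
  ∑[ c < N ] (binomial (suc r) a * term c)
    ≡⟨ sumBelow-cong N (λ c → reassociate (binomial (suc r) a) (blocks (r ∸ k) c a) (binomial x c) _) ⟩
  ∑[ c < N ] (blocks (suc r) (suc c) a * binomial x c * cappedMaps k (r ∸ k ∸ c * a) (x ∸ c))
    ≡⟨ sumBelow-cong N (λ c → cong (λ d → blocks (suc r) (suc c) a * binomial x c * cappedMaps k d (x ∸ c))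
                                   (∸-+-assoc (suc r) a (c * a))) ⟩
  ∑[ c < N ] (blocks (suc r) (suc c) a * binomial x c * cappedMaps k (suc r ∸ suc c * a) (x ∸ c)) ∎
  where
  open ≡-Reasoning
  a = suc k
  term : ℕ → ℕ
  term c = blocks (r ∸ k) c a * binomial x c * cappedMaps k (r ∸ k ∸ c * a) (x ∸ c)
  reassociate : ∀ p m b h → p * (m * b * h) ≡ p * m * b * h
  reassociate = solve-∀

fullFibreExpansion-suc : ∀ {k x} → FullFibreExpansion k x → FullFibreExpansion k (suc x)
fullFibreExpansion-suc {k} {x} expand (suc N) r r<1+N = begin
  cappedMaps (suc k) r (suc x)
    ≡⟨ sumBelow-last (suc k) (λ j → binomial r j * cappedMaps (suc k) (r ∸ j) x) ⟩
  ∑[ j < suc k ] (binomial r j * cappedMaps (suc k) (r ∸ j) x) + binomial r (suc k) * cappedMaps (suc k) (r ∸ suc k) x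
    ≡⟨ cong₂ _+_ (lastFibre-notFull expand N r r<1+N) (lastFibre-full expand N r r<1+N) ⟩
  ∑[ c < suc N ] (blocks r c (suc k) * binomial x c * cappedMaps k (r ∸ c * suc k) (suc x ∸ c)) +
  ∑[ c < N ] (blocks r (suc c) (suc k) * binomial x c * cappedMaps k (r ∸ suc c * suc k) (x ∸ c))
    ≡⟨ fullFibreSum-pascal k N r x ⟩
  fullFibreSum k (suc N) r (suc x) ∎
  where open ≡-Reasoning

cappedMaps-byFullFibres : ∀ k x → FullFibreExpansion k x
cappedMaps-byFullFibres k zero    = fullFibreExpansion-zero k
cappedMaps-byFullFibres k (suc x) = fullFibreExpansion-suc (cappedMaps-byFullFibres k x)

-- Multiplicities of parts and the coefficient of a partition

mult-++ : ∀ v xs ys → mult v (xs ++ ys) ≡ mult v xs + mult v ys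
mult-++ v xs ys = trans (cong length (filter-++ (_≟ v) xs ys)) (length-++ (filter (_≟ v) xs))

mult-replicate : ∀ c a → mult a (replicate c a) ≡ c
mult-replicate c a = trans (cong length (filter-all (_≟ a) (replicate⁺ c refl))) (length-replicate c)

mult-absent : ∀ {v xs} → All (_≢ v) xs → mult v xs ≡ 0
mult-absent {v} xs≢v = cong length (filter-none (_≟ v) xs≢v)

-- Both suc x ≟ suc a and x ≟ a reduce to x ≡ᵇ a, so abstracting over it decides both filters at once.
mult-suc-map-suc : ∀ a xs → mult (suc a) (map suc xs) ≡ mult a xs
mult-suc-map-suc a []       = refl
mult-suc-map-suc a (x ∷ xs) with x ≡ᵇ a
... | true  = cong suc (mult-suc-map-suc a xs)
... | false = mult-suc-map-suc a xs

mult-zero-map-suc : ∀ xs → mult 0 (map suc xs) ≡ 0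
mult-zero-map-suc []       = refl
mult-zero-map-suc (x ∷ xs) = mult-zero-map-suc xs

mult-upTo : ∀ {a R} → a < R → mult a (upTo R) ≡ 1
mult-upTo {zero}  {suc R} _ =
  cong suc (trans (cong (mult 0) (sym (map-applyUpTo (λ i → i) suc R))) (mult-zero-map-suc (upTo R)))
mult-upTo {suc a} {suc R} (s≤s a<R) =
  trans (cong (mult (suc a)) (sym (map-applyUpTo (λ i → i) suc R)))
        (trans (mult-suc-map-suc a (upTo R)) (mult-upTo a<R))

product-map-≢⇒1 : ∀ {a} (e : ℕ → ℕ) → (∀ v → v ≢ a → e v ≡ 1) → ∀ xs → product (map e xs) ≡ e a ^ mult a xs
product-map-≢⇒1         e e≡1 []       = refl
product-map-≢⇒1 {a} e e≡1 (x ∷ xs) with x ≟ a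
... | yes refl = trans (cong (e x *_) (product-map-≢⇒1 e e≡1 xs))
                      (cong (e x ^_) (sym (cong length (filter-accept (_≟ x) {xs = xs} refl))))
... | no x≢a   = trans (cong₂ _*_ (e≡1 x x≢a) (product-map-≢⇒1 e e≡1 xs))
                      (trans (*-identityˡ _) (cong (e a ^_) (sym (cong length (filter-reject (_≟ a) {xs = xs} x≢a)))))

product-values-≢⇒1 : ∀ {a R} (e : ℕ → ℕ) → a < R → (∀ v → v ≢ suc a → e v ≡ 1) →
                     product (map e (values R)) ≡ e (suc a)
product-values-≢⇒1 {a} {R} e a<R e≡1 = begin
  product (map e (values R))          ≡⟨ product-map-≢⇒1 e e≡1 (values R) ⟩
  e (suc a) ^ mult (suc a) (values R) ≡⟨ cong (e (suc a) ^_) (trans (mult-suc-map-suc a (upTo R)) (mult-upTo a<R)) ⟩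
  e (suc a) ^ 1                       ≡⟨ *-identityʳ (e (suc a)) ⟩
  e (suc a)                           ∎
  where open ≡-Reasoning

denom1-[] : ∀ R → denom1 R [] ≡ 1
denom1-[] R = product-map-1 (values R)

denom2-[] : ∀ R → denom2 R [] ≡ 1
denom2-[] R = product-map-1 (values R)

denom1-++ : ∀ R xs ys → denom1 R (xs ++ ys) ≡ denom1 R xs * denom1 R ys
denom1-++ R xs ys = trans (cong product (map-cong split (values R))) (product-map-* _ _ (values R))
  where
  split : ∀ v → (v !) ^ mult v (xs ++ ys) ≡ (v !) ^ mult v xs * (v !) ^ mult v ys
  split v = trans (cong ((v !) ^_) (mult-++ v xs ys)) (^-distribˡ-+-* (v !) (mult v xs) (mult v ys))

denom2-++ : ∀ R xs ys → (∀ v → mult v xs ≡ 0 ⊎ mult v ys ≡ 0) → denom2 R (xs ++ ys) ≡ denom2 R xs * denom2 R ys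
denom2-++ R xs ys disjoint = trans (cong product (map-cong split (values R))) (product-map-* _ _ (values R))
  where
  [m+n]!≡m!*n! : ∀ m n → m ≡ 0 ⊎ n ≡ 0 → (m + n) ! ≡ m ! * n !
  [m+n]!≡m!*n! _ n (inj₁ refl) = sym (+-identityʳ (n !))
  [m+n]!≡m!*n! m _ (inj₂ refl) = trans (cong _! (+-identityʳ m)) (sym (*-identityʳ (m !)))
  split : ∀ v → mult v (xs ++ ys) ! ≡ mult v xs ! * mult v ys !
  split v = trans (cong _! (mult-++ v xs ys)) ([m+n]!≡m!*n! (mult v xs) (mult v ys) (disjoint v))

denom1-replicate : ∀ R c {k} → k < R → denom1 R (replicate c (suc k)) ≡ (suc k !) ^ c
denom1-replicate R c {k} k<R =
  trans (product-values-≢⇒1 _ k<R (λ v v≢a → cong ((v !) ^_) (mult-absent (replicate⁺ c (v≢a ∘ sym)))))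
        (cong ((suc k !) ^_) (mult-replicate c (suc k)))

denom2-replicate : ∀ R c {k} → k < R → denom2 R (replicate c (suc k)) ≡ c !
denom2-replicate R c {k} k<R =
  trans (product-values-≢⇒1 _ k<R (λ v v≢a → cong _! (mult-absent (replicate⁺ c (v≢a ∘ sym)))))
        (cong _! (mult-replicate c (suc k)))

-- coeff r P is weight r r P; keeping the range R of part values apart from r lets r shrink in the recursion.
weight : ℕ → ℕ → List ℕ → ℕ
weight R r P = (r ! / denom1 R P) {{denom1-nz R P}} * (length P ! / denom2 R P) {{denom2-nz R P}}

record Admissible (R k r : ℕ) (P : List ℕ) : Set where
  field
    parts≤ : All (_≤ k) P
    denom1∣r! : denom1 R P ∣ r !
    denom2∣m! : denom2 R P ∣ length P !
open Admissible

/-quotient : ∀ {d n} (d∣n : d ∣ n) .{{_ : NonZero d}} → n / d ≡ quotient d∣n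
/-quotient {d} (divides q refl) = m*n/n≡m q d

weight≡quotients : ∀ {R k r P} (A : Admissible R k r P) →
                   weight R r P ≡ quotient (denom1∣r! A) * quotient (denom2∣m! A)
weight≡quotients {R} {P = P} A =
  cong₂ _*_ (/-quotient (denom1∣r! A) {{denom1-nz R P}}) (/-quotient (denom2∣m! A) {{denom2-nz R P}})

module _ {R k r c : ℕ} {P′ : List ℕ} (k<R : k < R) (c*a≤r : c * suc k ≤ r)
         (A : Admissible R k (r ∸ c * suc k) P′) where
  private
    a = suc k
    P = replicate c a ++ P′
    m′ = length P′

  length-block : length P ≡ c + m′
  length-block = trans (length-++ (replicate c a)) (cong (_+ m′) (length-replicate c))

  r!≡blocks*quotient*denom1 : r ! ≡ blocks r c a * quotient (denom1∣r! A) * denom1 R P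
  r!≡blocks*quotient*denom1 = begin
    r !
      ≡⟨ blocks*[a!]^c*[r∸c*a]!≡r! r c a c*a≤r ⟨
    blocks r c a * ((a !) ^ c * (r ∸ c * a) !)
      ≡⟨ cong (λ u → blocks r c a * ((a !) ^ c * u)) (_∣_.equality (denom1∣r! A)) ⟩
    blocks r c a * ((a !) ^ c * (quotient (denom1∣r! A) * denom1 R P′))
      ≡⟨ rearrange (blocks r c a) (quotient (denom1∣r! A)) ((a !) ^ c) (denom1 R P′) ⟩
    blocks r c a * quotient (denom1∣r! A) * ((a !) ^ c * denom1 R P′)
      ≡⟨ cong (λ d → blocks r c a * quotient (denom1∣r! A) * (d * denom1 R P′)) (denom1-replicate R c k<R) ⟨
    blocks r c a * quotient (denom1∣r! A) * (denom1 R (replicate c a) * denom1 R P′)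
      ≡⟨ cong (blocks r c a * quotient (denom1∣r! A) *_) (denom1-++ R (replicate c a) P′) ⟨
    blocks r c a * quotient (denom1∣r! A) * denom1 R P ∎
    where
    open ≡-Reasoning
    rearrange : ∀ m q p d → m * (p * (q * d)) ≡ m * q * (p * d)
    rearrange = solve-∀

  m!≡binomial*quotient*denom2 : length P ! ≡ binomial (c + m′) c * quotient (denom2∣m! A) * denom2 R P
  m!≡binomial*quotient*denom2 = begin
    length P !
      ≡⟨ cong _! length-block ⟩
    (c + m′) !
      ≡⟨ binomial[m+n,m]*m!*n!≡[m+n]! c m′ ⟨
    binomial (c + m′) c * (c ! * m′ !)
      ≡⟨ cong (λ u → binomial (c + m′) c * (c ! * u)) (_∣_.equality (denom2∣m! A)) ⟩
    binomial (c + m′) c * (c ! * (quotient (denom2∣m! A) * denom2 R P′))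
      ≡⟨ rearrange (binomial (c + m′) c) (quotient (denom2∣m! A)) (c !) (denom2 R P′) ⟩
    binomial (c + m′) c * quotient (denom2∣m! A) * (c ! * denom2 R P′)
      ≡⟨ cong (λ d → binomial (c + m′) c * quotient (denom2∣m! A) * (d * denom2 R P′)) (denom2-replicate R c k<R) ⟨
    binomial (c + m′) c * quotient (denom2∣m! A) * (denom2 R (replicate c a) * denom2 R P′)
      ≡⟨ cong (binomial (c + m′) c * quotient (denom2∣m! A) *_) (denom2-++ R (replicate c a) P′ disjoint) ⟨
    binomial (c + m′) c * quotient (denom2∣m! A) * denom2 R P ∎
    where
    open ≡-Reasoning
    rearrange : ∀ m q p d → m * (p * (q * d)) ≡ m * q * (p * d)
    rearrange = solve-∀
    disjoint : ∀ v → mult v (replicate c a) ≡ 0 ⊎ mult v P′ ≡ 0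
    disjoint v with v ≟ a
    ... | yes v≡a = inj₂ (mult-absent (All.map (λ p≤k p≡v → <-irrefl (trans p≡v v≡a) (s≤s p≤k)) (parts≤ A)))
    ... | no v≢a  = inj₁ (mult-absent (replicate⁺ c (v≢a ∘ sym)))

  admissible-block : Admissible R a r P
  admissible-block = record
    { parts≤    = ++⁺ (replicate⁺ c ≤-refl) (All.map m≤n⇒m≤1+n (parts≤ A))
    ; denom1∣r! = divides (blocks r c a * quotient (denom1∣r! A)) r!≡blocks*quotient*denom1
    ; denom2∣m! = divides (binomial (c + m′) c * quotient (denom2∣m! A)) m!≡binomial*quotient*denom2
    }

  weight-block : weight R r P ≡ blocks r c a * binomial (c + m′) c * weight R (r ∸ c * a) P′
  weight-block = begin
    weight R r P
      ≡⟨ weight≡quotients admissible-block ⟩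
    blocks r c a * q₁ * (binomial (c + m′) c * q₂)
      ≡⟨ rearrange (blocks r c a) q₁ (binomial (c + m′) c) q₂ ⟩
    blocks r c a * binomial (c + m′) c * (q₁ * q₂)
      ≡⟨ cong (blocks r c a * binomial (c + m′) c *_) (weight≡quotients A) ⟨
    blocks r c a * binomial (c + m′) c * weight R (r ∸ c * a) P′ ∎
    where
    open ≡-Reasoning
    q₁ = quotient (denom1∣r! A)
    q₂ = quotient (denom2∣m! A)
    rearrange : ∀ m q b p → m * q * (b * p) ≡ m * b * (q * p)
    rearrange = solve-∀

  weight*binomial-block : ∀ x → weight R r P * binomial x (length P) ≡
                          blocks r c a * binomial x c * (weight R (r ∸ c * a) P′ * binomial (x ∸ c) m′)
  weight*binomial-block x = begin
    weight R r P * binomial x (length P)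
      ≡⟨ cong₂ (λ w l → w * binomial x l) weight-block length-block ⟩
    blocks r c a * binomial (c + m′) c * w′ * binomial x (c + m′)
      ≡⟨ rearrange (blocks r c a) (binomial (c + m′) c) w′ (binomial x (c + m′)) ⟩
    blocks r c a * w′ * (binomial (c + m′) c * binomial x (c + m′))
      ≡⟨ cong (blocks r c a * w′ *_) (binomial-trinomial c m′ x) ⟩
    blocks r c a * w′ * (binomial x c * binomial (x ∸ c) m′)
      ≡⟨ rearrange′ (blocks r c a) w′ (binomial x c) (binomial (x ∸ c) m′) ⟩
    blocks r c a * binomial x c * (w′ * binomial (x ∸ c) m′) ∎
    where
    open ≡-Reasoning
    w′ = weight R (r ∸ c * a) P′
    rearrange : ∀ m b w y → m * b * w * y ≡ m * w * (b * y)
    rearrange = solve-∀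
    rearrange′ : ∀ m w b y → m * w * (b * y) ≡ m * b * (w * y)
    rearrange′ = solve-∀

admissible-[] : ∀ R → Admissible R 0 0 []
admissible-[] R = record
  { parts≤    = []
  ; denom1∣r! = divides 1 (sym (trans (*-identityˡ _) (denom1-[] R)))
  ; denom2∣m! = divides 1 (sym (trans (*-identityˡ _) (denom2-[] R)))
  }

ptn-admissible : ∀ R k → k ≤ R → ∀ r → All (Admissible R k r) (ptn k r)
ptn-admissible R zero    _   zero    = admissible-[] R ∷ []
ptn-admissible R zero    _   (suc r) = []
ptn-admissible R (suc k) k<R r =
  concat⁺ (map⁺ (All.map (λ {c} c*a≤r → map⁺ (All.map (admissible-block {c = c} k<R c*a≤r)
                                                   (ptn-admissible R k (<⇒≤ k<R) (r ∸ c * suc k))))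
                         (all-filter (λ c → c * suc k ≤? r) (upTo (suc r)))))

sum-ptn-weight*binomial : ∀ R k → k ≤ R → ∀ r x →
  sum (map (λ P → weight R r P * binomial x (length P)) (ptn k r)) ≡ cappedMaps k r x
sum-ptn-weight*binomial R zero _ zero x = begin
  weight R 0 [] * 1 + 0      ≡⟨ trans (+-identityʳ _) (*-identityʳ _) ⟩
  weight R 0 []              ≡⟨ weight≡quotients (admissible-[] R) ⟩
  1                          ≡⟨ cappedMaps-zeroCap 0 x ⟨
  cappedMaps 0 0 x           ∎
  where open ≡-Reasoning
sum-ptn-weight*binomial R zero _ (suc r) x = sym (cappedMaps-zeroCap (suc r) x)
sum-ptn-weight*binomial R (suc k) k<R r x = begin
  sum (map term (concatMap blockPartitions (filter fits? (upTo (suc r)))))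
    ≡⟨ sum-map-concatMap term blockPartitions (filter fits? (upTo (suc r))) ⟩
  sum (map (λ c → sum (map term (blockPartitions c))) (filter fits? (upTo (suc r))))
    ≡⟨ cong sum (map-cong-local (All.map (λ {c} → perBlockCount c) (all-filter fits? (upTo (suc r))))) ⟩
  sum (map fullFibreTerm (filter fits? (upTo (suc r))))
    ≡⟨ sum-map-filter fits? fullFibreTerm (λ c c*a≰r → m≡0⇒m*n≡0 _ (m≡0⇒m*n≡0 _ (r<c*a⇒blocks≡0 c (≰⇒> c*a≰r))))
                      (upTo (suc r)) ⟩
  sum (map fullFibreTerm (upTo (suc r)))
    ≡⟨ sum-map-applyUpTo fullFibreTerm (λ c → c) (suc r) ⟩
  fullFibreSum k (suc r) r x
    ≡⟨ cappedMaps-byFullFibres k x (suc r) r ≤-refl ⟨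
  cappedMaps (suc k) r x ∎
  where
  open ≡-Reasoning
  a = suc k
  term : List ℕ → ℕ
  term P = weight R r P * binomial x (length P)
  fits? : ∀ c → Dec (c * a ≤ r)
  fits? c = c * a ≤? r
  blockPartitions : ℕ → List (List ℕ)
  blockPartitions c = map (replicate c a ++_) (ptn k (r ∸ c * a))
  fullFibreTerm : ℕ → ℕ
  fullFibreTerm c = blocks r c a * binomial x c * cappedMaps k (r ∸ c * a) (x ∸ c)
  perBlockCount : ∀ c → c * a ≤ r → sum (map term (blockPartitions c)) ≡ fullFibreTerm c
  perBlockCount c c*a≤r = begin
    sum (map term (map (replicate c a ++_) (ptn k (r ∸ c * a))))
      ≡⟨ cong sum (map-∘ (ptn k (r ∸ c * a))) ⟨
    sum (map (term ∘ (replicate c a ++_)) (ptn k (r ∸ c * a)))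
      ≡⟨ cong sum (map-cong-local (All.map (λ A → weight*binomial-block {c = c} k<R c*a≤r A x)
                                           (ptn-admissible R k (<⇒≤ k<R) (r ∸ c * a)))) ⟩
    sum (map (λ P′ → blocks r c a * binomial x c * (weight R (r ∸ c * a) P′ * binomial (x ∸ c) (length P′)))
             (ptn k (r ∸ c * a)))
      ≡⟨ sum-map-distribˡ-* (blocks r c a * binomial x c) _ (ptn k (r ∸ c * a)) ⟩
    blocks r c a * binomial x c * sum (map (λ P′ → weight R (r ∸ c * a) P′ * binomial (x ∸ c) (length P′))
                                           (ptn k (r ∸ c * a)))
      ≡⟨ cong (blocks r c a * binomial x c *_) (sum-ptn-weight*binomial R k (<⇒≤ k<R) (r ∸ c * a) (x ∸ c)) ⟩
    fullFibreTerm c ∎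

pow≡sum-partitions : ∀ r x → x ^ r ≡ sum (map (λ P → coeff r P * binomial x (length P)) (partitions r))
pow≡sum-partitions r x =
  trans (sym (cappedMaps-pow r r x ≤-refl)) (sym (sum-ptn-weight*binomial r r ≤-refl r x))

-- The one-shuffle model

sum-choose-product : ∀ m L (f : ℕ → ℕ) → (∀ i → f i ≡ 0 ⊎ f i ≡ 1) →
                     sum (map (λ is → product (map f is)) (choose m L)) ≡ binomial (sum (map f L)) m
sum-choose-product zero    L        f f01 = refl
sum-choose-product (suc m) []       f f01 = refl
sum-choose-product (suc m) (x ∷ xs) f f01 = begin
  sum (map Π (map (x ∷_) (choose m xs) ++ choose (suc m) xs))
    ≡⟨ cong sum (map-++ Π (map (x ∷_) (choose m xs)) (choose (suc m) xs)) ⟩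
  sum (map Π (map (x ∷_) (choose m xs)) ++ map Π (choose (suc m) xs))
    ≡⟨ sum-++ (map Π (map (x ∷_) (choose m xs))) _ ⟩
  sum (map Π (map (x ∷_) (choose m xs))) + sum (map Π (choose (suc m) xs))
    ≡⟨ cong₂ _+_ (trans (cong sum (sym (map-∘ (choose m xs)))) (sum-map-distribˡ-* (f x) Π (choose m xs)))
                 (sum-choose-product (suc m) xs f f01) ⟩
  f x * sum (map Π (choose m xs)) + binomial s (suc m)
    ≡⟨ cong (λ u → f x * u + binomial s (suc m)) (sum-choose-product m xs f f01) ⟩
  f x * binomial s m + binomial s (suc m)
    ≡⟨ pascal (f x) (f01 x) ⟩
  binomial (f x + s) (suc m) ∎
  where
  open ≡-Reasoning
  Π : List ℕ → ℕ
  Π is = product (map f is)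
  s = sum (map f xs)
  pascal : ∀ y → y ≡ 0 ⊎ y ≡ 1 → y * binomial s m + binomial s (suc m) ≡ binomial (y + s) (suc m)
  pascal _ (inj₁ refl) = refl
  pascal _ (inj₂ refl) = cong (_+ binomial s (suc m)) (+-identityʳ (binomial s m))

module _ {n : ℕ} where
  private
    Outcome = ℕ → Vec Bool n → ℕ
    outcomes : ℕ → List (Vec Bool n)
    outcomes t = filter (λ S → card S ≟ t) (allSubsets n)

  C-cong : ∀ {W W′ : Outcome} → (∀ t S → W t S ≡ W′ t S) → C W ≡ C W′
  C-cong W≗W′ = cong sum (map-cong (λ t → cong sum (map-cong (W≗W′ t) (outcomes t))) (upTo (suc n)))

  C-scale : ∀ k (W : Outcome) → C (λ t S → k * W t S) ≡ k * C W
  C-scale k W = trans (cong sum (map-cong (λ t → sum-map-distribˡ-* k (W t) (outcomes t)) (upTo (suc n))))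
                      (sum-map-distribˡ-* k (λ t → sum (map (W t) (outcomes t))) (upTo (suc n)))

  C-sum : ∀ {A : Set} (F : A → Outcome) xs → sum (map (λ a → C (F a)) xs) ≡ C (λ t S → sum (map (λ a → F a t S) xs))
  C-sum F xs = trans (sum-map-comm (λ a t → sum (map (F a t) (outcomes t))) xs (upTo (suc n)))
                     (cong sum (map-cong (λ t → sum-map-comm (λ a → F a t) xs (outcomes t)) (upTo (suc n))))

Y≡0⊎Y≡1 : ∀ {n} i t (S : Vec Bool n) → Y i t S ≡ 0 ⊎ Y i t S ≡ 1
Y≡0⊎Y≡1 i t S = indicator _
  where
  indicator : ∀ b → (if b then 1 else 0) ≡ 0 ⊎ (if b then 1 else 0) ≡ 1
  indicator true  = inj₂ refl
  indicator false = inj₁ refl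

M≡C[binomial[YA]] : ∀ n m → M n m ≡ C (λ t S → binomial (YA n t S) m)
M≡C[binomial[YA]] n m =
  trans (C-sum {n} (λ is t S → product (map (λ i → Y i t S) is)) (choose m (positions ⌈ n /2⌉)))
        (C-cong {n} (λ t S → sum-choose-product m (positions ⌈ n /2⌉) (λ i → Y i t S) (λ i → Y≡0⊎Y≡1 i t S)))

proposition4 : (n r : ℕ) → 1 ≤ n → 1 ≤ r → C (λ t S → YA n t S ^ r) ≡ RHS n r
proposition4 n r _ _ = begin
  C (λ t S → YA n t S ^ r)
    ≡⟨ C-cong {n} (λ t S → pow≡sum-partitions r (YA n t S)) ⟩
  C (λ t S → sum (map (λ P → coeff r P * binomial (YA n t S) (length P)) (partitions r)))
    ≡⟨ C-sum {n} (λ P t S → coeff r P * binomial (YA n t S) (length P)) (partitions r) ⟨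
  sum (map (λ P → C (λ t S → coeff r P * binomial (YA n t S) (length P))) (partitions r))
    ≡⟨ cong sum (map-cong (λ P → trans (C-scale {n} (coeff r P) _) (cong (coeff r P *_) (sym (M≡C[binomial[YA]] n (length P)))))
                          (partitions r)) ⟩
  RHS n r ∎
  where open ≡-Reasoning
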